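{- Let $k \in \mathbb{N}$ and let $G$ be a digraph. If $H$ is a $k$-node strong connectivity certificate of $G$, then $H$ is also a $k$-arc strong connectivity certificate of $G$.
   Context: All digraphs are simple. For a digraph $G=(V,A)$ and distinct nodes $s,t\in V$, $\kappa_{st}(G)$ denotes the maximum number of pairwise internally node-disjoint directed paths from $s$ to $t$ in $G$, and $\lambda_{st}(G)$ denotes the maximum number of pairwise arc-disjoint directed paths from $s$ to $t$ in $G$. A $k$-node (resp. $k$-arc) strong connectivity certificate of $G$ is a subgraph $H=(V,A')$ with $A'\subseteq A$ such that for every pair of distinct nodes $s,t\in V$, $\kappa_{st}(H)\ge \min\{k,\kappa_{st}(G)\}$ (resp. $\lambda_{st}(H)\ge\min\{k,\lambda_{st}(G)\}$). -}

module Defs where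

open import Data.Nat using (ℕ; _≤_)
open import Data.Fin using (Fin)
open import Data.Bool using (Bool; true; false)
open import Data.List using (List; []; _∷_)
open import Data.List.Membership.Propositional using (_∈_)
open import Data.List.Relation.Unary.Unique.Propositional using (Unique)
open import Data.Product using (Σ; _×_; _,_)
open import Data.Empty using (⊥)
open import Relation.Nullary using (¬_)
open import Relation.Binary.PropositionalEquality using (_≡_; _≢_)

-- A simple digraph on the node set Fin n: an arc relation (at most one arc
-- per ordered pair) without loops.
record Digraph (n : ℕ) : Set where
  field
    arc      : Fin n → Fin n → Bool
    loopless : ∀ v → arc v v ≡ false
open Digraph public

_⊆ᴳ_ : ∀ {n} → Digraph n → Digraph n → Set
H ⊆ᴳ G = ∀ u v → arc H u v ≡ true → arc G u v ≡ true

data Walk {n : ℕ} (G : Digraph n) : Fin n → Fin n → List (Fin n) → Set where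
  here : ∀ {v} → Walk G v v (v ∷ [])
  step : ∀ {u w t vs} → arc G u w ≡ true → Walk G w t vs → Walk G u t (u ∷ vs)

IsPath : ∀ {n} → Digraph n → Fin n → Fin n → List (Fin n) → Set
IsPath G s t vs = Walk G s t vs × Unique vs

dropLast : ∀ {a} {A : Set a} → List A → List A
dropLast []           = []
dropLast (x ∷ [])     = []
dropLast (x ∷ y ∷ ys) = x ∷ dropLast (y ∷ ys)

internal : ∀ {a} {A : Set a} → List A → List A
internal []       = []
internal (x ∷ xs) = dropLast xs

arcsOf : ∀ {a} {A : Set a} → List A → List (A × A)
arcsOf []           = []
arcsOf (x ∷ [])     = []
arcsOf (x ∷ y ∷ ys) = (x , y) ∷ arcsOf (y ∷ ys)

NodeDisjointPaths : ∀ {n} → Digraph n → Fin n → Fin n → ℕ → Set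
NodeDisjointPaths {n} G s t m =
  Σ (Fin m → List (Fin n)) λ P →
    (∀ i → IsPath G s t (P i)) ×
    (∀ i j → i ≢ j →
       (P i ≢ P j) × (∀ v → v ∈ internal (P i) → v ∈ internal (P j) → ⊥))

ArcDisjointPaths : ∀ {n} → Digraph n → Fin n → Fin n → ℕ → Set
ArcDisjointPaths {n} G s t m =
  Σ (Fin m → List (Fin n)) λ P →
    (∀ i → IsPath G s t (P i)) ×
    (∀ i j → i ≢ j → ∀ e → e ∈ arcsOf (P i) → e ∈ arcsOf (P j) → ⊥)

-- κ_st(H) ≥ min{k, κ_st(G)} for all s ≠ t, unfolded: every m ≤ k with
-- κ_st(G) ≥ m also has κ_st(H) ≥ m.
NodeCertificate : ∀ {n} → ℕ → Digraph n → Digraph n → Set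
NodeCertificate {n} k G H =
  H ⊆ᴳ G ×
  (∀ (s t : Fin n) → s ≢ t → ∀ m → m ≤ k →
     NodeDisjointPaths G s t m → NodeDisjointPaths H s t m)

ArcCertificate : ∀ {n} → ℕ → Digraph n → Digraph n → Set
ArcCertificate {n} k G H =
  H ⊆ᴳ G ×
  (∀ (s t : Fin n) → s ≢ t → ∀ m → m ≤ k →
     ArcDisjointPaths G s t m → ArcDisjointPaths H s t m)

{-# OPTIONS --safe #-}
module Submission where

-- If an arc xy of G is missing from H, then H has k node-disjoint x-y paths:
-- from j < k of them, adding the path (x, y) gives j + 1 such paths in G, hence
-- in H.  These are arc-disjoint as well, so it suffices to show that deleting
-- an arc xy from a digraph that keeps k arc-disjoint x-y paths preserves every
-- family of m ≤ k arc-disjoint s-t paths; the arcs of G outside H are then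
-- deleted one at a time.  View the m paths as a 0/1 flow.  If it uses xy,
-- dropping xy leaves an s-t flow of value m with one extra unit of supply at y
-- and of demand at x.  Either the residual graph has an x-y path, and
-- augmenting along it gives an s-t flow avoiding xy, which decomposes into m
-- arc-disjoint paths; or the nodes residually reaching y form a set Y whose
-- entering arcs all carry flow while no flow leaves Y, and conservation over Y
-- bounds the number of arcs entering Y by m - 1 < k, although each of the k
-- arc-disjoint x-y paths enters Y.

open import Defs
open import Algebra.Properties.CommutativeMonoid.Sum as Sum using ()
open import Algebra.Properties.CommutativeSemigroup as CommutativeSemigroupProperties using ()
open import Data.Bool.Base using (Bool; true; false; _∧_; _∨_; not)
open import Data.Bool.Properties
  using (∧-zeroʳ; ∧-identityʳ; ∨-identityʳ; ∨-zeroʳ; not-injective) renaming (_≟_ to _≟ᴮ_)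
open import Data.Empty using (⊥; ⊥-elim)
open import Data.Fin.Base using (Fin; zero; suc)
open import Data.Fin.Properties using (_≟_; any?; suc-injective)
open import Data.List.Base using (List; []; _∷_; cartesianProduct; allFin)
open import Data.List.Membership.Propositional using (_∈_)
open import Data.List.Membership.Propositional.Properties using (∈-cartesianProduct⁺; ∈-allFin)
open import Data.List.Relation.Unary.All as All using (All; []; _∷_)
open import Data.List.Relation.Unary.All.Properties using (¬Any⇒All¬; All¬⇒¬Any)
open import Data.List.Relation.Unary.AllPairs using ([]; _∷_)
open import Data.List.Relation.Unary.Any as Any using (here; there)
open import Data.List.Relation.Unary.Unique.Propositional using (Unique)
open import Data.Nat.Base using (ℕ; zero; suc; _+_; _*_; _≤_; _<_; z≤n; s≤s)
open import Data.Nat.Properties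
  using ( ≤-refl; <⇒≤; <⇒≱; n≮n; n<1+n; m≤n+m; m<m+n; +-suc; +-identityʳ; +-comm; +-assoc
        ; +-cancelˡ-≡; +-cancelʳ-≡; +-mono-≤; +-monoˡ-≤; *-zeroʳ; *-identityʳ; *-distribˡ-+
        ; *-monoʳ-≤; +-0-commutativeMonoid; +-commutativeSemigroup; *-commutativeSemigroup
        ; module ≤-Reasoning )
open import Data.Nat.Tactic.RingSolver using (solve-∀)
open import Data.Product using (∃; _×_; _,_; proj₁; proj₂)
open import Data.Sum using (_⊎_; inj₁; inj₂; [_,_]′)
open import Function.Base using (_∘_)
open import Relation.Nullary using (Dec; yes; no; does)
open import Relation.Nullary.Decidable using (dec-true; dec-false; _×-dec_)
open import Relation.Binary.PropositionalEquality

open Sum +-0-commutativeMonoid using (sum; ∑-distrib-+; ∑-comm; sum-cong-≗)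
open CommutativeSemigroupProperties +-commutativeSemigroup
  using (interchange; xy∙z≈y∙xz; xy∙z≈y∙zx; xy∙z≈xz∙y)
open CommutativeSemigroupProperties *-commutativeSemigroup
  using () renaming (x∙yz≈y∙xz to *-left-comm)

ArcSet : ℕ → Set
ArcSet n = Fin n → Fin n → Bool

NodeSet : ℕ → Set
NodeSet n = Fin n → Bool

variable
  n m k : ℕ
  a b s t u w x y : Fin n
  vs : List (Fin n)
  E F : ArcSet n
  Y : NodeSet n
  σ τ σ′ τ′ ρ : Fin n → ℕ
  D G H : Digraph n

false≢true : false ≢ true
false≢true ()

not-true : ∀ {p} → not p ≡ true → p ≡ true → ⊥
not-true {true}  () _
not-true {false} _  ()

∧-elim : ∀ p {q} → p ∧ q ≡ true → p ≡ true × q ≡ true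
∧-elim true q = refl , q

∧-intro : ∀ {p q} → p ≡ true → q ≡ true → p ∧ q ≡ true
∧-intro refl q = q

∨-elim : ∀ p {q} → p ∨ q ≡ true → p ≡ true ⊎ q ≡ true
∨-elim true  _ = inj₁ refl
∨-elim false q = inj₂ q

∨-introˡ : ∀ {p} q → p ≡ true → p ∨ q ≡ true
∨-introˡ _ refl = refl

∨-introʳ : ∀ p {q} → q ≡ true → p ∨ q ≡ true
∨-introʳ p refl = ∨-zeroʳ p

≟-true : does (a ≟ b) ≡ true → a ≡ b
≟-true {a = a} {b = b} h with a ≟ b
... | yes a≡b = a≡b

-- Counting

𝟙 : Bool → ℕ
𝟙 true  = 1
𝟙 false = 0

𝟙≤1 : ∀ p → 𝟙 p ≤ 1
𝟙≤1 true  = ≤-refl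
𝟙≤1 false = z≤n

𝟙-mono : ∀ {p q} → (p ≡ true → q ≡ true) → 𝟙 p ≤ 𝟙 q
𝟙-mono {true}  p⇒q rewrite p⇒q refl = ≤-refl
𝟙-mono {false} _ = z≤n

𝟙-∨ : ∀ p q → (p ≡ true → q ≡ true → ⊥) → 𝟙 (p ∨ q) ≡ 𝟙 p + 𝟙 q
𝟙-∨ true  true  disjoint = ⊥-elim (disjoint refl refl)
𝟙-∨ true  false _ = refl
𝟙-∨ false _     _ = refl

𝟙-∧ : ∀ p q → 𝟙 p * 𝟙 q ≡ 𝟙 (p ∧ q)
𝟙-∧ true  q = +-identityʳ (𝟙 q)
𝟙-∧ false _ = refl

𝟙-split : ∀ p q → 𝟙 q ≡ 𝟙 (p ∧ q) + 𝟙 (not p ∧ q)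
𝟙-split true  q = sym (+-identityʳ (𝟙 q))
𝟙-split false _ = refl

sum-zero : ∀ {n} {f : Fin n → ℕ} → (∀ i → f i ≡ 0) → sum f ≡ 0
sum-zero {zero}  _   = refl
sum-zero {suc n} f≡0 = cong₂ _+_ (f≡0 zero) (sum-zero (f≡0 ∘ suc))

sum-mono-≤ : ∀ {n} {f g : Fin n → ℕ} → (∀ i → f i ≤ g i) → sum f ≤ sum g
sum-mono-≤ {zero}  _   = z≤n
sum-mono-≤ {suc n} f≤g = +-mono-≤ (f≤g zero) (sum-mono-≤ (f≤g ∘ suc))

sum-*ˡ : ∀ {n} c (f : Fin n → ℕ) → sum (λ i → c * f i) ≡ c * sum f
sum-*ˡ {zero}  c f = sym (*-zeroʳ c)
sum-*ˡ {suc n} c f = trans (cong (c * f zero +_) (sum-*ˡ c (f ∘ suc)))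
                           (sym (*-distribˡ-+ c (f zero) (sum (f ∘ suc))))

δ : Fin n → Fin n → ℕ
δ b a = 𝟙 (does (a ≟ b))

sum-δ : ∀ {n} (b : Fin n) → sum (δ b) ≡ 1
sum-δ {suc n} zero    = cong suc (sum-zero {n} λ _ → refl)
sum-δ {suc n} (suc b) = sum-δ b

sum-*δ : ∀ {n} (f : Fin n → ℕ) b → sum (λ a → f a * δ b a) ≡ f b
sum-*δ {suc n} f zero = trans
  (cong₂ _+_ (*-identityʳ (f zero)) (sum-zero λ a → *-zeroʳ (f (suc a))))
  (+-identityʳ (f zero))
sum-*δ {suc n} f (suc b) =
  trans (cong (_+ sum (λ a → f (suc a) * δ b a)) (*-zeroʳ (f zero))) (sum-*δ {n} (f ∘ suc) b)

_⊕_ : (Fin n → ℕ) → (Fin n → ℕ) → Fin n → ℕ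
(f ⊕ g) a = f a + g a

_⊛_ : ℕ → (Fin n → ℕ) → Fin n → ℕ
(c ⊛ f) a = c * f a

∁ : NodeSet n → NodeSet n
∁ Y a = not (Y a)

⁅_⁆ : Fin n → NodeSet n
⁅ y ⁆ a = does (a ≟ y)

insert : Fin n → NodeSet n → NodeSet n
insert a Y c = Y c ∨ ⁅ a ⁆ c

count : NodeSet n → ℕ
count Y = sum (𝟙 ∘ Y)

count≤n : ∀ {n} (Y : NodeSet n) → count Y ≤ n
count≤n {zero}  _ = z≤n
count≤n {suc n} Y = +-mono-≤ (𝟙≤1 (Y zero)) (count≤n (Y ∘ suc))

count-insert : ∀ (Y : NodeSet n) a → Y a ≡ false → count (insert a Y) ≡ suc (count Y)
count-insert Y a Ya≡false = begin
  sum (λ c → 𝟙 (Y c ∨ ⁅ a ⁆ c))   ≡⟨ sum-cong-≗ (λ c → 𝟙-∨ (Y c) _ (distinct c)) ⟩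
  sum (λ c → 𝟙 (Y c) + δ a c)      ≡⟨ ∑-distrib-+ (𝟙 ∘ Y) (δ a) ⟩
  count Y + sum (δ a)              ≡⟨ cong (count Y +_) (sum-δ a) ⟩
  count Y + 1                      ≡⟨ +-comm (count Y) 1 ⟩
  suc (count Y)                    ∎
  where
  open ≡-Reasoning
  distinct : ∀ c → Y c ≡ true → ⁅ a ⁆ c ≡ true → ⊥
  distinct c Yc c≡a = false≢true (trans (sym Ya≡false) (subst (λ z → Y z ≡ true) (≟-true c≡a) Yc))

sumOver : NodeSet n → (Fin n → ℕ) → ℕ
sumOver Y f = sum λ a → 𝟙 (Y a) * f a

sumOver-⊕ : ∀ (Y : NodeSet n) f g → sumOver Y (f ⊕ g) ≡ sumOver Y f + sumOver Y g
sumOver-⊕ Y f g = trans (sum-cong-≗ λ a → *-distribˡ-+ (𝟙 (Y a)) (f a) (g a))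
                        (∑-distrib-+ (λ a → 𝟙 (Y a) * f a) (λ a → 𝟙 (Y a) * g a))

sumOver-δ : ∀ (Y : NodeSet n) b → sumOver Y (δ b) ≡ 𝟙 (Y b)
sumOver-δ Y = sum-*δ (𝟙 ∘ Y)

sumOver-⊛δ : ∀ (Y : NodeSet n) c b → sumOver Y (c ⊛ δ b) ≡ c * 𝟙 (Y b)
sumOver-⊛δ Y c b = begin
  sum (λ a → 𝟙 (Y a) * (c * δ b a))  ≡⟨ sum-cong-≗ (λ a → *-left-comm (𝟙 (Y a)) c (δ b a)) ⟩
  sum (λ a → c * (𝟙 (Y a) * δ b a))  ≡⟨ sum-*ˡ c (λ a → 𝟙 (Y a) * δ b a) ⟩
  c * sumOver Y (δ b)                ≡⟨ cong (c *_) (sumOver-δ Y b) ⟩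
  c * 𝟙 (Y b)                        ∎
  where open ≡-Reasoning

-- Arc sets and flows

∅ : ArcSet n
∅ _ _ = false

_∪_ : ArcSet n → ArcSet n → ArcSet n
(E ∪ F) a b = E a b ∨ F a b

_∖_ : ArcSet n → ArcSet n → ArcSet n
(E ∖ F) a b = E a b ∧ not (F a b)

⁅_⟶_⁆ : Fin n → Fin n → ArcSet n
⁅ u ⟶ w ⁆ a b = does (a ≟ u) ∧ does (b ≟ w)

⋃ : (Fin m → ArcSet n) → ArcSet n
⋃ {m = zero}  _  = ∅
⋃ {m = suc m} Es = Es zero ∪ ⋃ (Es ∘ suc)

_⊆ᴬ_ : ArcSet n → ArcSet n → Set
E ⊆ᴬ F = ∀ a b → E a b ≡ true → F a b ≡ true

Disjoint : ArcSet n → ArcSet n → Set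
Disjoint E F = ∀ a b → E a b ≡ true → F a b ≡ true → ⊥

⁅⁆-self : ∀ (u w : Fin n) → ⁅ u ⟶ w ⁆ u w ≡ true
⁅⁆-self u w = cong₂ _∧_ (dec-true (u ≟ u) refl) (dec-true (w ≟ w) refl)

⁅⁆-true : ∀ (u w a b : Fin n) → ⁅ u ⟶ w ⁆ a b ≡ true → a ≡ u × b ≡ w
⁅⁆-true u w a b uw = let (a≡u , b≡w) = ∧-elim (does (a ≟ u)) uw in ≟-true a≡u , ≟-true b≡w

⁅⁆-source≢ : a ≢ u → ⁅ u ⟶ w ⁆ a b ≡ false
⁅⁆-source≢ {a = a} {u = u} a≢u = cong (_∧ _) (dec-false (a ≟ u) a≢u)

⁅⁆-target≢ : b ≢ w → ⁅ u ⟶ w ⁆ a b ≡ false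
⁅⁆-target≢ {b = b} {w = w} {u = u} {a = a} b≢w =
  trans (cong (does (a ≟ u) ∧_) (dec-false (b ≟ w) b≢w)) (∧-zeroʳ _)

⁅⁆-⊆ : E u w ≡ true → ⁅ u ⟶ w ⁆ ⊆ᴬ E
⁅⁆-⊆ {u = u} {w = w} Euw a b uw with ⁅⁆-true u w a b uw
... | refl , refl = Euw

⋃-elim : (Es : Fin m → ArcSet n) → ⋃ Es a b ≡ true → ∃ λ i → Es i a b ≡ true
⋃-elim {m = zero} _ ()
⋃-elim {m = suc m} {a = a} {b = b} Es e with ∨-elim (Es zero a b) e
... | inj₁ e₀ = zero , e₀
... | inj₂ e₁ = let (i , eᵢ) = ⋃-elim (Es ∘ suc) e₁ in suc i , eᵢ

⋃-⊆ : {Es : Fin m → ArcSet n} → (∀ i → Es i ⊆ᴬ F) → ⋃ Es ⊆ᴬ F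
⋃-⊆ {Es = Es} Es⊆F a b e = let (i , eᵢ) = ⋃-elim Es e in Es⊆F i a b eᵢ

∖-disjoint : Disjoint (E ∖ F) F
∖-disjoint {E = E} {F = F} a b e f = not-true (proj₂ (∧-elim (E a b) e)) f

∖-∪-⊆ : F ⊆ᴬ E → ∀ a b → ((E ∖ F) ∪ F) a b ≡ E a b
∖-∪-⊆ {F = F} {E = E} F⊆E a b with E a b in e | F a b in f
... | true  | true  = refl
... | true  | false = refl
... | false | true  = ⊥-elim (false≢true (trans (sym e) (F⊆E a b f)))
... | false | false = refl

outDeg inDeg : ArcSet n → Fin n → ℕ
outDeg E a = sum λ b → 𝟙 (E a b)
inDeg  E a = sum λ b → 𝟙 (E b a)

outDeg-∪ : Disjoint E F → ∀ a → outDeg (E ∪ F) a ≡ outDeg E a + outDeg F a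
outDeg-∪ {E = E} {F = F} disjoint a =
  trans (sum-cong-≗ λ b → 𝟙-∨ (E a b) (F a b) (disjoint a b))
        (∑-distrib-+ (λ b → 𝟙 (E a b)) (λ b → 𝟙 (F a b)))

inDeg-∪ : Disjoint E F → ∀ a → inDeg (E ∪ F) a ≡ inDeg E a + inDeg F a
inDeg-∪ {E = E} {F = F} disjoint a =
  trans (sum-cong-≗ λ b → 𝟙-∨ (E b a) (F b a) (disjoint b a))
        (∑-distrib-+ (λ b → 𝟙 (E b a)) (λ b → 𝟙 (F b a)))

outDeg-∖ : F ⊆ᴬ E → ∀ a → outDeg (E ∖ F) a + outDeg F a ≡ outDeg E a
outDeg-∖ {F = F} {E = E} F⊆E a =
  trans (sym (outDeg-∪ (∖-disjoint {E = E} {F = F}) a)) (sum-cong-≗ λ b → cong 𝟙 (∖-∪-⊆ F⊆E a b))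

inDeg-∖ : F ⊆ᴬ E → ∀ a → inDeg (E ∖ F) a + inDeg F a ≡ inDeg E a
inDeg-∖ {F = F} {E = E} F⊆E a =
  trans (sym (inDeg-∪ (∖-disjoint {E = E} {F = F}) a)) (sum-cong-≗ λ b → cong 𝟙 (∖-∪-⊆ F⊆E b a))

outDeg-⁅⁆ : ∀ (u w a : Fin n) → outDeg ⁅ u ⟶ w ⁆ a ≡ δ u a
outDeg-⁅⁆ {n} u w a with a ≟ u
... | yes _ = sum-δ w
... | no  _ = sum-zero {n} λ _ → refl

inDeg-⁅⁆ : ∀ (u w a : Fin n) → inDeg ⁅ u ⟶ w ⁆ a ≡ δ w a
inDeg-⁅⁆ u w a with a ≟ w
... | yes _ = trans (sum-cong-≗ λ b → cong 𝟙 (∧-identityʳ (does (b ≟ u)))) (sum-δ u)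
... | no  _ = sum-zero λ b → cong 𝟙 (∧-zeroʳ (does (b ≟ u)))

-- E carries σ a units into the network and τ a units out of it at each node a:
-- outflow − inflow = σ − τ, stated without subtraction.
IsFlow : ArcSet n → (Fin n → ℕ) → (Fin n → ℕ) → Set
IsFlow E σ τ = ∀ a → outDeg E a + τ a ≡ inDeg E a + σ a

flow-∅ : IsFlow ∅ σ σ
flow-∅ _ = refl

flow-⁅⁆ : ∀ (u w : Fin n) → IsFlow ⁅ u ⟶ w ⁆ (δ u) (δ w)
flow-⁅⁆ u w a rewrite outDeg-⁅⁆ u w a | inDeg-⁅⁆ u w a = +-comm (δ u a) (δ w a)

flow-congᴬ : (∀ a b → E a b ≡ F a b) → IsFlow E σ τ → IsFlow F σ τ
flow-congᴬ {E = E} {F = F} {σ = σ} {τ = τ} E≗F flow a =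
  subst₂ (λ o i → o + τ a ≡ i + σ a)
    (sum-cong-≗ λ b → cong 𝟙 (E≗F a b)) (sum-cong-≗ λ b → cong 𝟙 (E≗F b a)) (flow a)

flow-cancel : (∀ a → σ′ a ≡ σ a + ρ a) → (∀ a → τ′ a ≡ τ a + ρ a) →
  IsFlow E σ′ τ′ → IsFlow E σ τ
flow-cancel {σ′ = σ′} {σ = σ} {ρ = ρ} {τ′ = τ′} {τ = τ} {E = E} σ′≡ τ′≡ flow a =
  +-cancelʳ-≡ (ρ a) _ _ (begin
    outDeg E a + τ a + ρ a    ≡⟨ +-assoc (outDeg E a) (τ a) (ρ a) ⟩
    outDeg E a + (τ a + ρ a)  ≡⟨ cong (outDeg E a +_) (τ′≡ a) ⟨
    outDeg E a + τ′ a         ≡⟨ flow a ⟩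
    inDeg E a + σ′ a          ≡⟨ cong (inDeg E a +_) (σ′≡ a) ⟩
    inDeg E a + (σ a + ρ a)   ≡⟨ +-assoc (inDeg E a) (σ a) (ρ a) ⟨
    inDeg E a + σ a + ρ a     ∎)
  where open ≡-Reasoning

flow-∪ : Disjoint E F → IsFlow E σ τ → IsFlow F σ′ τ′ → IsFlow (E ∪ F) (σ ⊕ σ′) (τ ⊕ τ′)
flow-∪ {E = E} {F = F} {σ = σ} {τ = τ} {σ′ = σ′} {τ′ = τ′} disjoint flowE flowF a = begin
  outDeg (E ∪ F) a + (τ a + τ′ a)           ≡⟨ cong (_+ _) (outDeg-∪ disjoint a) ⟩
  (outDeg E a + outDeg F a) + (τ a + τ′ a)  ≡⟨ interchange (outDeg E a) (outDeg F a) (τ a) (τ′ a) ⟩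
  (outDeg E a + τ a) + (outDeg F a + τ′ a)  ≡⟨ cong₂ _+_ (flowE a) (flowF a) ⟩
  (inDeg E a + σ a) + (inDeg F a + σ′ a)    ≡⟨ interchange (inDeg E a) (σ a) (inDeg F a) (σ′ a) ⟩
  (inDeg E a + inDeg F a) + (σ a + σ′ a)    ≡⟨ cong (_+ _) (inDeg-∪ disjoint a) ⟨
  inDeg (E ∪ F) a + (σ a + σ′ a)            ∎
  where open ≡-Reasoning

flow-∖ : F ⊆ᴬ E → IsFlow E σ τ → IsFlow F σ′ τ′ → IsFlow (E ∖ F) (σ ⊕ τ′) (τ ⊕ σ′)
flow-∖ {F = F} {E = E} {σ = σ} {τ = τ} {σ′ = σ′} {τ′ = τ′} F⊆E flowE flowF a =
  +-cancelʳ-≡ iF _ _ (begin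
    o + (τ a + σ′ a) + iF        ≡⟨ regroup o (τ a) (σ′ a) iF ⟩
    o + τ a + (iF + σ′ a)        ≡⟨ cong (o + τ a +_) (flowF a) ⟨
    o + τ a + (oF + τ′ a)        ≡⟨ regroup′ o (τ a) oF (τ′ a) ⟩
    (o + oF) + τ a + τ′ a        ≡⟨ cong (λ z → z + τ a + τ′ a) (outDeg-∖ F⊆E a) ⟩
    outDeg E a + τ a + τ′ a      ≡⟨ cong (_+ τ′ a) (flowE a) ⟩
    inDeg E a + σ a + τ′ a       ≡⟨ cong (λ z → z + σ a + τ′ a) (inDeg-∖ F⊆E a) ⟨
    (i + iF) + σ a + τ′ a        ≡⟨ regroup″ i iF (σ a) (τ′ a) ⟩
    i + (σ a + τ′ a) + iF        ∎)
  where
  open ≡-Reasoning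
  o i oF iF : ℕ
  o  = outDeg (E ∖ F) a
  i  = inDeg (E ∖ F) a
  oF = outDeg F a
  iF = inDeg F a
  regroup : ∀ p q r s → p + (q + r) + s ≡ p + q + (s + r)
  regroup = solve-∀
  regroup′ : ∀ p q r s → p + q + (r + s) ≡ p + r + q + s
  regroup′ = solve-∀
  regroup″ : ∀ p q r s → p + q + r + s ≡ p + (r + s) + q
  regroup″ = solve-∀

⋃-flow : {Es : Fin m → ArcSet n} → (∀ i j → i ≢ j → Disjoint (Es i) (Es j)) →
  (∀ i → IsFlow (Es i) σ τ) → IsFlow (⋃ Es) (m ⊛ σ) (m ⊛ τ)
⋃-flow {m = zero}            _        _     _ = refl
⋃-flow {m = suc m} {Es = Es} disjoint flows =
  flow-∪ first (flows zero)
    (⋃-flow (λ i j i≢j → disjoint (suc i) (suc j) (i≢j ∘ suc-injective)) (flows ∘ suc))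
  where
  first : Disjoint (Es zero) (⋃ (Es ∘ suc))
  first a b e₀ e = let (i , eᵢ) = ⋃-elim (Es ∘ suc) e in disjoint zero (suc i) (λ ()) a b e₀ eᵢ

-- Cuts

arcsBetween : ArcSet n → NodeSet n → NodeSet n → ℕ
arcsBetween E S T = sum λ a → sum λ b → 𝟙 (S a ∧ (T b ∧ E a b))

arcsBetween-mono : ∀ {S T : NodeSet n} →
  (∀ a b → S a ≡ true → T b ≡ true → E a b ≡ true → F a b ≡ true) →
  arcsBetween E S T ≤ arcsBetween F S T
arcsBetween-mono {E = E} {F = F} {S = S} {T = T} E⇒F =
  sum-mono-≤ λ a → sum-mono-≤ λ b → 𝟙-mono λ h →
    let (Sa , TbEab) = ∧-elim (S a) h; (Tb , Eab) = ∧-elim (T b) TbEab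
    in ∧-intro Sa (∧-intro Tb (E⇒F a b Sa Tb Eab))

arcsBetween-none : ∀ {S T : NodeSet n} →
  (∀ a b → S a ≡ true → T b ≡ true → E a b ≡ true → ⊥) → arcsBetween E S T ≡ 0
arcsBetween-none {E = E} {S = S} {T = T} none =
  sum-zero λ a → sum-zero λ b → cong 𝟙 (∧-false (S a) (T b) (E a b) (none a b))
  where
  ∧-false : ∀ p q r → (p ≡ true → q ≡ true → r ≡ true → ⊥) → p ∧ (q ∧ r) ≡ false
  ∧-false true  true  true  none = ⊥-elim (none refl refl refl)
  ∧-false true  true  false _    = refl
  ∧-false true  false _     _    = refl
  ∧-false false _     _     _    = refl

sumOver-outDeg : ∀ (E : ArcSet n) Y →
  sumOver Y (outDeg E) ≡ arcsBetween E Y Y + arcsBetween E Y (∁ Y)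
sumOver-outDeg E Y = begin
  sum (λ a → 𝟙 (Y a) * sum (λ b → 𝟙 (E a b)))
    ≡⟨ sum-cong-≗ (λ a → sum-*ˡ (𝟙 (Y a)) (λ b → 𝟙 (E a b))) ⟨
  sum (λ a → sum (λ b → 𝟙 (Y a) * 𝟙 (E a b)))
    ≡⟨ sum-cong-≗ (λ a → sum-cong-≗ λ b → split (Y a) (Y b) (E a b)) ⟩
  sum (λ a → sum (λ b → inside a b + leaving a b))
    ≡⟨ sum-cong-≗ (λ a → ∑-distrib-+ (inside a) (leaving a)) ⟩
  sum (λ a → sum (inside a) + sum (leaving a))
    ≡⟨ ∑-distrib-+ (sum ∘ inside) (sum ∘ leaving) ⟩
  arcsBetween E Y Y + arcsBetween E Y (∁ Y)
    ∎
  where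
  open ≡-Reasoning
  inside leaving : Fin _ → Fin _ → ℕ
  inside  a b = 𝟙 (Y a ∧ (Y b ∧ E a b))
  leaving a b = 𝟙 (Y a ∧ (not (Y b) ∧ E a b))
  split : ∀ p q r → 𝟙 p * 𝟙 r ≡ 𝟙 (p ∧ (q ∧ r)) + 𝟙 (p ∧ (not q ∧ r))
  split true  q r = trans (+-identityʳ (𝟙 r)) (𝟙-split q r)
  split false _ _ = refl

sumOver-inDeg : ∀ (E : ArcSet n) Y →
  sumOver Y (inDeg E) ≡ arcsBetween E Y Y + arcsBetween E (∁ Y) Y
sumOver-inDeg E Y = begin
  sum (λ a → 𝟙 (Y a) * sum (λ b → 𝟙 (E b a)))
    ≡⟨ sum-cong-≗ (λ a → sum-*ˡ (𝟙 (Y a)) (λ b → 𝟙 (E b a))) ⟨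
  sum (λ a → sum (λ b → 𝟙 (Y a) * 𝟙 (E b a)))
    ≡⟨ ∑-comm (λ a b → 𝟙 (Y a) * 𝟙 (E b a)) ⟩
  sum (λ b → sum (λ a → 𝟙 (Y a) * 𝟙 (E b a)))
    ≡⟨ sum-cong-≗ (λ b → sum-cong-≗ λ a →
         trans (𝟙-∧ (Y a) (E b a)) (𝟙-split (Y b) (Y a ∧ E b a))) ⟩
  sum (λ b → sum (λ a → inside b a + entering b a))
    ≡⟨ sum-cong-≗ (λ b → ∑-distrib-+ (inside b) (entering b)) ⟩
  sum (λ b → sum (inside b) + sum (entering b))
    ≡⟨ ∑-distrib-+ (sum ∘ inside) (sum ∘ entering) ⟩
  arcsBetween E Y Y + arcsBetween E (∁ Y) Y
    ∎
  where
  open ≡-Reasoning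
  inside entering : Fin _ → Fin _ → ℕ
  inside   b a = 𝟙 (Y b ∧ (Y a ∧ E b a))
  entering b a = 𝟙 (not (Y b) ∧ (Y a ∧ E b a))

flow-conservation : IsFlow E σ τ → ∀ Y →
  arcsBetween E Y (∁ Y) + sumOver Y τ ≡ arcsBetween E (∁ Y) Y + sumOver Y σ
flow-conservation {E = E} {σ = σ} {τ = τ} flow Y = +-cancelˡ-≡ inside _ _ (begin
  inside + (arcsBetween E Y (∁ Y) + sumOver Y τ)   ≡⟨ +-assoc inside _ _ ⟨
  inside + arcsBetween E Y (∁ Y) + sumOver Y τ     ≡⟨ cong (_+ sumOver Y τ) (sumOver-outDeg E Y) ⟨
  sumOver Y (outDeg E) + sumOver Y τ               ≡⟨ sumOver-⊕ Y (outDeg E) τ ⟨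
  sumOver Y (outDeg E ⊕ τ)                         ≡⟨ sum-cong-≗ (λ a → cong (𝟙 (Y a) *_) (flow a)) ⟩
  sumOver Y (inDeg E ⊕ σ)                          ≡⟨ sumOver-⊕ Y (inDeg E) σ ⟩
  sumOver Y (inDeg E) + sumOver Y σ                ≡⟨ cong (_+ sumOver Y σ) (sumOver-inDeg E Y) ⟩
  inside + arcsBetween E (∁ Y) Y + sumOver Y σ     ≡⟨ +-assoc inside _ _ ⟩
  inside + (arcsBetween E (∁ Y) Y + sumOver Y σ)   ∎)
  where
  open ≡-Reasoning
  inside : ℕ
  inside = arcsBetween E Y Y

-- Walks and paths

arcSet : List (Fin n) → ArcSet n
arcSet (u ∷ w ∷ vs) = ⁅ u ⟶ w ⁆ ∪ arcSet (w ∷ vs)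
arcSet _            = ∅

arcSet-∷ : Walk D w t vs → ∀ u a b → arcSet (u ∷ vs) a b ≡ (⁅ u ⟶ w ⁆ ∪ arcSet vs) a b
arcSet-∷ here       _ _ _ = refl
arcSet-∷ (step _ _) _ _ _ = refl

arcsOf⇒arcSet : ∀ (vs : List (Fin n)) → (a , b) ∈ arcsOf vs → arcSet vs a b ≡ true
arcsOf⇒arcSet (u ∷ w ∷ vs) (here refl) = ∨-introˡ _ (⁅⁆-self u w)
arcsOf⇒arcSet {a = a} {b = b} (u ∷ w ∷ vs) (there ab) =
  ∨-introʳ (⁅ u ⟶ w ⁆ a b) (arcsOf⇒arcSet (w ∷ vs) ab)

arcSet⇒arcsOf : ∀ (vs : List (Fin n)) → arcSet vs a b ≡ true → (a , b) ∈ arcsOf vs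
arcSet⇒arcsOf {a = a} {b = b} (u ∷ vs@(w ∷ _)) e =
  [ (λ uw → let (a≡u , b≡w) = ⁅⁆-true u w a b uw in here (cong₂ _,_ a≡u b≡w))
  , there ∘ arcSet⇒arcsOf vs
  ]′ (∨-elim (⁅ u ⟶ w ⁆ a b) e)

arcSet-source∈ : ∀ (vs : List (Fin n)) → arcSet vs a b ≡ true → a ∈ vs
arcSet-source∈ {a = a} {b = b} (u ∷ vs@(w ∷ _)) e =
  [ here ∘ proj₁ ∘ ⁅⁆-true u w a b , there ∘ arcSet-source∈ vs ]′ (∨-elim (⁅ u ⟶ w ⁆ a b) e)

arcSet-target∈ : ∀ v (vs : List (Fin n)) → arcSet (v ∷ vs) a b ≡ true → b ∈ vs
arcSet-target∈ {a = a} {b = b} v (w ∷ vs) e =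
  [ here ∘ proj₂ ∘ ⁅⁆-true v w a b , there ∘ arcSet-target∈ w vs ]′ (∨-elim (⁅ v ⟶ w ⁆ a b) e)

walk-⊆ : arc D ⊆ᴬ arc G → Walk D s t vs → Walk G s t vs
walk-⊆ D⊆G here        = here
walk-⊆ D⊆G (step uw W) = step (D⊆G _ _ uw) (walk-⊆ D⊆G W)

walk-first : Walk D s t vs → s ∈ vs
walk-first here       = here refl
walk-first (step _ _) = here refl

walk-last : Walk D s t vs → t ∈ vs
walk-last here       = here refl
walk-last (step _ W) = there (walk-last W)

walk-loop : Walk D w w vs → Unique vs → vs ≡ w ∷ []
walk-loop here       _          = refl
walk-loop (step _ W) (w∉vs ∷ _) = ⊥-elim (All¬⇒¬Any w∉vs (walk-last W))

arcSet-walk : Walk D s t vs → arcSet vs ⊆ᴬ arc D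
arcSet-walk (step {u = u} {w = w} uw W) a b e
  with ∨-elim (⁅ u ⟶ w ⁆ a b) (subst (_≡ true) (arcSet-∷ W u a b) e)
... | inj₂ e′ = arcSet-walk W a b e′
... | inj₁ e′ with ⁅⁆-true u w a b e′
...   | refl , refl = uw

path-flow : IsPath D s t vs → IsFlow (arcSet vs) (δ s) (δ t)
path-flow (here , _) = flow-∅
path-flow {vs = u ∷ vs} (step {w = w} {t = t} _ W , u∉vs ∷ unique) =
  flow-congᴬ (λ a b → sym (arcSet-∷ W u a b))
    (flow-cancel {ρ = δ w} (λ _ → refl) (λ a → +-comm (δ w a) (δ t a))
      (flow-∪ first (flow-⁅⁆ u w) (path-flow (W , unique))))
  where
  first : Disjoint ⁅ u ⟶ w ⁆ (arcSet vs)
  first a b uw e with ⁅⁆-true u w a b uw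
  ... | refl , refl = All¬⇒¬Any u∉vs (arcSet-source∈ vs e)

suffix : IsPath D s t vs → a ∈ vs → ∃ λ ws → IsPath D a t ws
suffix (here , unique)         (here refl)  = _ , here , unique
suffix (step uw W , unique)    (here refl)  = _ , step uw W , unique
suffix (step _ W , _ ∷ unique) (there a∈vs) = suffix (W , unique) a∈vs

shortcut : Walk D s t vs → ∃ λ ws → IsPath D s t ws
shortcut here = _ , here , [] ∷ []
shortcut (step {u = u} uw W) with shortcut W
... | ws , W′ , unique with Any.any? (u ≟_) ws
...   | yes u∈ws = suffix (W′ , unique) u∈ws
...   | no  u∉ws = u ∷ ws , step uw W′ , ¬Any⇒All¬ ws u∉ws ∷ unique

dropLast-∷ : Walk D w t vs → ∀ u → dropLast (u ∷ vs) ≡ u ∷ dropLast vs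
dropLast-∷ here       _ = refl
dropLast-∷ (step _ _) _ = refl

∈-dropLast : Walk D w t vs → a ∈ vs → a ≢ t → a ∈ dropLast vs
∈-dropLast here               (here refl) a≢t = ⊥-elim (a≢t refl)
∈-dropLast (step {u = u} _ W) (here a≡u)  _   = subst (_ ∈_) (sym (dropLast-∷ W u)) (here a≡u)
∈-dropLast (step {u = u} _ W) (there a∈)  a≢t =
  subst (_ ∈_) (sym (dropLast-∷ W u)) (there (∈-dropLast W a∈ a≢t))

arcSet-source≢target : IsPath D s t vs → arcSet vs a b ≡ true → a ≢ t
arcSet-source≢target {a = a} {b = b} (step {u = u} {w = w} _ W , u∉vs ∷ unique) e
  with ∨-elim (⁅ u ⟶ w ⁆ a b) (subst (_≡ true) (arcSet-∷ W u a b) e)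
... | inj₂ e′ = arcSet-source≢target (W , unique) e′
... | inj₁ uw with ⁅⁆-true u w a b uw
...   | refl , refl = λ u≡t → All¬⇒¬Any u∉vs (subst (_∈ _) (sym u≡t) (walk-last W))

arcSet-source-internal : IsPath D s t vs → arcSet vs a b ≡ true → a ≢ s → a ∈ internal vs
arcSet-source-internal {vs = vs} {a = a} {b = b} path@(step _ W , _) e a≢s
  with arcSet-source∈ {a = a} {b = b} vs e
... | here a≡s = ⊥-elim (a≢s a≡s)
... | there a∈ = ∈-dropLast W a∈ (arcSet-source≢target path e)

arcSet-target-internal : Walk D s t vs → arcSet vs a b ≡ true → b ≢ t → b ∈ internal vs
arcSet-target-internal (step {u = u} _ W) e b≢t = ∈-dropLast W (arcSet-target∈ u _ e) b≢t

arcSet-direct : IsPath D s t vs → arcSet vs s t ≡ true → vs ≡ s ∷ t ∷ []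
arcSet-direct {s = s} {t = t} (step {w = w} _ W , s∉vs ∷ unique) e
  with ∨-elim (⁅ s ⟶ w ⁆ s t) (subst (_≡ true) (arcSet-∷ W s s t) e)
... | inj₂ e′ = ⊥-elim (All¬⇒¬Any s∉vs (arcSet-source∈ _ e′))
... | inj₁ sw with ⁅⁆-true s w s t sw
...   | _ , refl = cong (s ∷_) (walk-loop W unique)

nodeDisjoint⇒arcDisjoint : NodeDisjointPaths D s t m → ArcDisjointPaths D s t m
nodeDisjoint⇒arcDisjoint {s = s} {t = t} (Ps , paths , disjoint) = Ps , paths , arcDisjoint
  where
  arcDisjoint : ∀ i j → i ≢ j → ∀ e → e ∈ arcsOf (Ps i) → e ∈ arcsOf (Ps j) → ⊥
  arcDisjoint i j i≢j (a , b) ∈i ∈j with a ≟ s | b ≟ t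
  ... | no a≢s | _ = proj₂ (disjoint i j i≢j) a
          (arcSet-source-internal (paths i) (arcsOf⇒arcSet _ ∈i) a≢s)
          (arcSet-source-internal (paths j) (arcsOf⇒arcSet _ ∈j) a≢s)
  ... | yes _ | no b≢t = proj₂ (disjoint i j i≢j) b
          (arcSet-target-internal (proj₁ (paths i)) (arcsOf⇒arcSet _ ∈i) b≢t)
          (arcSet-target-internal (proj₁ (paths j)) (arcsOf⇒arcSet _ ∈j) b≢t)
  ... | yes refl | yes refl = proj₁ (disjoint i j i≢j)
          (trans (arcSet-direct (paths i) (arcsOf⇒arcSet _ ∈i))
                 (sym (arcSet-direct (paths j) (arcsOf⇒arcSet _ ∈j))))

arcDisjointPaths-mono : arc D ⊆ᴬ arc G → ArcDisjointPaths D s t m → ArcDisjointPaths G s t m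
arcDisjointPaths-mono D⊆G (Ps , paths , disjoint) =
  Ps , (λ i → walk-⊆ D⊆G (proj₁ (paths i)) , proj₂ (paths i)) , disjoint

nodeDisjointPaths-mono : arc D ⊆ᴬ arc G → NodeDisjointPaths D s t m → NodeDisjointPaths G s t m
nodeDisjointPaths-mono D⊆G (Ps , paths , disjoint) =
  Ps , (λ i → walk-⊆ D⊆G (proj₁ (paths i)) , proj₂ (paths i)) , disjoint

arcDisjointPaths-cons : IsPath D s t vs → (A : ArcDisjointPaths D s t m) →
  (∀ i → Disjoint (arcSet vs) (arcSet (proj₁ A i))) → ArcDisjointPaths D s t (suc m)
arcDisjointPaths-cons {D = D} {s = s} {t = t} {vs = vs} {m = m} path (Ps , paths , disjoint) new =
  Ps′ , paths′ , disjoint′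
  where
  Ps′ : Fin (suc m) → List (Fin _)
  Ps′ zero    = vs
  Ps′ (suc i) = Ps i
  paths′ : ∀ i → IsPath D s t (Ps′ i)
  paths′ zero    = path
  paths′ (suc i) = paths i
  disjoint′ : ∀ i j → i ≢ j → ∀ e → e ∈ arcsOf (Ps′ i) → e ∈ arcsOf (Ps′ j) → ⊥
  disjoint′ zero    zero    i≢j = ⊥-elim (i≢j refl)
  disjoint′ zero    (suc j) _   (a , b) e eⱼ = new j a b (arcsOf⇒arcSet vs e) (arcsOf⇒arcSet (Ps j) eⱼ)
  disjoint′ (suc i) zero    _   (a , b) eᵢ e = new i a b (arcsOf⇒arcSet vs e) (arcsOf⇒arcSet (Ps i) eᵢ)
  disjoint′ (suc i) (suc j) i≢j = disjoint i j (i≢j ∘ cong suc)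

pathUnion : {D : Digraph n} → ArcDisjointPaths D s t m → ArcSet n
pathUnion (Ps , _) = ⋃ (arcSet ∘ Ps)

pathUnion-⊆ : (A : ArcDisjointPaths D s t m) → pathUnion A ⊆ᴬ arc D
pathUnion-⊆ (_ , paths , _) = ⋃-⊆ (arcSet-walk ∘ proj₁ ∘ paths)

pathUnion-flow : (A : ArcDisjointPaths D s t m) → IsFlow (pathUnion A) (m ⊛ δ s) (m ⊛ δ t)
pathUnion-flow (Ps , paths , disjoint) = ⋃-flow
  (λ i j i≢j a b eᵢ eⱼ →
     disjoint i j i≢j (a , b) (arcSet⇒arcsOf (Ps i) eᵢ) (arcSet⇒arcsOf (Ps j) eⱼ))
  (path-flow ∘ paths)

-- Reachability

restrict : Digraph n → ArcSet n → Digraph n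
restrict D E = record
  { arc      = λ a b → arc D a b ∧ E a b
  ; loopless = λ v → cong (_∧ E v v) (loopless D v)
  }

restrict-⊆ˡ : arc (restrict D E) ⊆ᴬ arc D
restrict-⊆ˡ {D = D} a b e = proj₁ (∧-elim (arc D a b) e)

restrict-⊆ʳ : arc (restrict D E) ⊆ᴬ E
restrict-⊆ʳ {D = D} a b e = proj₂ (∧-elim (arc D a b) e)

removeArc : Digraph n → Fin n → Fin n → Digraph n
removeArc D x y = restrict D (λ a b → not (⁅ x ⟶ y ⁆ a b))

removeArc-⊆ : arc (removeArc D x y) ⊆ᴬ arc D
removeArc-⊆ {D = D} = restrict-⊆ˡ {D = D}

removeArc-removes : arc (removeArc D x y) x y ≢ true
removeArc-removes {D = D} {x = x} {y = y} e = not-true (proj₂ (∧-elim (arc D x y) e)) (⁅⁆-self x y)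

⊆-removeArc : F ⊆ᴬ arc D → F x y ≡ false → F ⊆ᴬ arc (removeArc D x y)
⊆-removeArc {F = F} {x = x} {y = y} F⊆D Fxy≡false a b Fab = ∧-intro (F⊆D a b Fab) (cong not avoids)
  where
  avoids : ⁅ x ⟶ y ⁆ a b ≡ false
  avoids with ⁅ x ⟶ y ⁆ a b in xy
  ... | false = refl
  ... | true with ⁅⁆-true x y a b xy
  ...   | refl , refl = ⊥-elim (false≢true (trans (sym Fxy≡false) Fab))

residual : Digraph n → ArcSet n → Digraph n
residual D E = record
  { arc      = λ a b → (arc D a b ∧ not (E a b)) ∨ (arc D b a ∧ E b a)
  ; loopless = λ v → cong₂ (λ p q → (p ∧ not (E v v)) ∨ (q ∧ E v v)) (loopless D v) (loopless D v)
  }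

Reaches : Digraph n → Fin n → Fin n → Set
Reaches D a y = ∃ λ vs → Walk D a y vs

PredClosed : Digraph n → NodeSet n → Set
PredClosed D Y = ∀ a b → arc D a b ≡ true → Y b ≡ true → Y a ≡ true

module _ (D : Digraph n) (y : Fin n) where

  private
    Entering : NodeSet n → Fin n → Fin n → Set
    Entering Y a b = Y a ≡ false × Y b ≡ true × arc D a b ≡ true

    entering? : ∀ Y a b → Dec (Entering Y a b)
    entering? Y a b = (Y a ≟ᴮ false) ×-dec (Y b ≟ᴮ true) ×-dec (arc D a b ≟ᴮ true)

  BackwardClosure : Set
  BackwardClosure = ∃ λ Y → Y y ≡ true × (∀ a → Y a ≡ true → Reaches D a y) × PredClosed D Y

  -- The fuel bounds the number of nodes that can still be added to Y.
  backwardClosure : ∀ fuel (Y : NodeSet n) → n ≤ count Y + fuel → Y y ≡ true →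
    (∀ a → Y a ≡ true → Reaches D a y) → BackwardClosure
  backwardClosure fuel Y fits Yy reach with any? (λ a → any? (entering? Y a))
  ... | no noneEntering = Y , Yy , reach , closed
    where
    closed : PredClosed D Y
    closed a b ab Yb with Y a in Ya
    ... | true  = refl
    ... | false = ⊥-elim (noneEntering (a , b , Ya , Yb , ab))
  ... | yes (a , b , Ya , Yb , ab) = grow fuel fits
    where
    reach′ : ∀ c → insert a Y c ≡ true → Reaches D c y
    reach′ c Y′c with ∨-elim (Y c) Y′c
    ... | inj₁ Yc  = reach c Yc
    ... | inj₂ c≡a = let (vs , W) = reach b Yb in
                     subst (λ z → Reaches D z y) (sym (≟-true c≡a)) (a ∷ vs , step ab W)
    grow : ∀ fuel → n ≤ count Y + fuel → BackwardClosure
    grow zero fits = ⊥-elim (n≮n (count Y) (begin-strict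
      count Y            <⟨ n<1+n (count Y) ⟩
      suc (count Y)      ≡⟨ count-insert Y a Ya ⟨
      count (insert a Y) ≤⟨ count≤n (insert a Y) ⟩
      n                  ≤⟨ fits ⟩
      count Y + 0        ≡⟨ +-identityʳ (count Y) ⟩
      count Y            ∎))
      where open ≤-Reasoning
    grow (suc fuel) fits = backwardClosure fuel (insert a Y)
      (subst (n ≤_) (trans (+-suc (count Y) fuel) (cong (_+ fuel) (sym (count-insert Y a Ya)))) fits)
      (∨-introˡ _ Yy) reach′

reachOrSeparate : ∀ (D : Digraph n) x y →
  Reaches D x y ⊎ ∃ λ Y → Y x ≡ false × Y y ≡ true × PredClosed D Y
reachOrSeparate {n} D x y with backwardClosure D y n ⁅ y ⁆ (m≤n+m n _) (dec-true (y ≟ y) refl) atY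
  where
  atY : ∀ a → ⁅ y ⁆ a ≡ true → Reaches D a y
  atY a a≡y = subst (λ z → Reaches D z y) (sym (≟-true a≡y)) (y ∷ [] , here)
... | Y , Yy , reach , closed with Y x in Yx
...   | true  = inj₁ (reach x Yx)
...   | false = inj₂ (Y , Yx , Yy , closed)

-- Decomposing and augmenting flows

demand≤supply : E ⊆ᴬ arc D → IsFlow E σ τ → PredClosed (restrict D E) Y → sumOver Y τ ≤ sumOver Y σ
demand≤supply {E = E} {D = D} {σ = σ} {τ = τ} {Y = Y} E⊆D flow closed = begin
  sumOver Y τ                                ≤⟨ m≤n+m (sumOver Y τ) _ ⟩
  arcsBetween E Y (∁ Y) + sumOver Y τ        ≡⟨ flow-conservation flow Y ⟩
  arcsBetween E (∁ Y) Y + sumOver Y σ        ≡⟨ cong (_+ sumOver Y σ) noneEntering ⟩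
  sumOver Y σ                                ∎
  where
  open ≤-Reasoning
  noneEntering : arcsBetween E (∁ Y) Y ≡ 0
  noneEntering = arcsBetween-none λ a b ∁Ya Yb Eab →
    not-true ∁Ya (closed a b (∧-intro (E⊆D a b Eab) Eab) Yb)

flow⇒path : E ⊆ᴬ arc D → IsFlow E (suc m ⊛ δ s) (suc m ⊛ δ t) →
  ∃ λ vs → IsPath (restrict D E) s t vs
flow⇒path {E = E} {D = D} {m = m} {s = s} {t = t} E⊆D flow with reachOrSeparate (restrict D E) s t
... | inj₁ (_ , W) = shortcut W
... | inj₂ (Y , Ys , Yt , closed) = ⊥-elim (<⇒≱ (s≤s z≤n) (begin
  suc m * 1                ≡⟨ cong (λ p → suc m * 𝟙 p) Yt ⟨
  suc m * 𝟙 (Y t)          ≡⟨ sumOver-⊛δ Y (suc m) t ⟨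
  sumOver Y (suc m ⊛ δ t)  ≤⟨ demand≤supply {E = E} {D = D} {σ = suc m ⊛ δ s} E⊆D flow closed ⟩
  sumOver Y (suc m ⊛ δ s)  ≡⟨ sumOver-⊛δ Y (suc m) s ⟩
  suc m * 𝟙 (Y s)          ≡⟨ cong (λ p → suc m * 𝟙 p) Ys ⟩
  suc m * 0                ≡⟨ *-zeroʳ (suc m) ⟩
  0                        ∎))
  where open ≤-Reasoning

flow⇒arcDisjointPaths : ∀ m → E ⊆ᴬ arc D → IsFlow E (m ⊛ δ s) (m ⊛ δ t) → ArcDisjointPaths D s t m
flow⇒arcDisjointPaths zero _ _ = (λ ()) , (λ ()) , (λ ())
flow⇒arcDisjointPaths {E = E} {D = D} {s = s} {t = t} (suc m) E⊆D flow
  with flow⇒path {E = E} {D = D} {m = m} {s = s} {t = t} E⊆D flow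
... | vs , (W , unique) = arcDisjointPaths-cons (walk-⊆ (restrict-⊆ˡ {D = D} {E = E}) W , unique)
                            (arcDisjointPaths-mono (restrict-⊆ˡ {D = D} {E = E′}) rest) new
  where
  E′ : ArcSet _
  E′ = E ∖ arcSet vs
  rest : ArcDisjointPaths (restrict D E′) s t m
  rest = flow⇒arcDisjointPaths {E = E′} {D = restrict D E′} m
    (λ a b e → ∧-intro (E⊆D a b (proj₁ (∧-elim (E a b) e))) e)
    (flow-cancel {ρ = δ s ⊕ δ t}
      (λ a → xy∙z≈y∙xz (δ s a) (m * δ s a) (δ t a))
      (λ a → xy∙z≈y∙zx (δ t a) (m * δ t a) (δ s a))
      (flow-∖ (λ a b → restrict-⊆ʳ {D = D} {E = E} a b ∘ arcSet-walk W a b) flow (path-flow (W , unique))))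
  new : ∀ i → Disjoint (arcSet vs) (arcSet (proj₁ rest i))
  new i a b e eᵢ = not-true (proj₂ (∧-elim (E a b) E′ab)) e
    where
    E′ab : E′ a b ≡ true
    E′ab = restrict-⊆ʳ {D = D} {E = E′} a b (arcSet-walk (proj₁ (proj₁ (proj₂ rest) i)) a b eᵢ)

walk-transport : (∀ a b → u ≢ a → u ≢ b → arc D a b ≡ arc G a b) →
  All (u ≢_) vs → Walk D w y vs → Walk G w y vs
walk-transport agree _             here        = here
walk-transport agree (u≢v ∷ u∉vs) (step ab W) =
  step (trans (sym (agree _ _ u≢v (All.lookup u∉vs (walk-first W)))) ab) (walk-transport agree u∉vs W)

residual-agree : ∀ {E′ : ArcSet n} → (∀ a b → u ≢ a → u ≢ b → E′ a b ≡ E a b) →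
  ∀ a b → u ≢ a → u ≢ b → arc (residual D E) a b ≡ arc (residual D E′) a b
residual-agree {D = D} agree a b u≢a u≢b =
  cong₂ (λ p q → (arc D a b ∧ not p) ∨ (arc D b a ∧ q))
    (sym (agree a b u≢a u≢b)) (sym (agree b a u≢b u≢a))

augment-step : E ⊆ᴬ arc D → arc (residual D E) u w ≡ true → IsFlow E σ (τ ⊕ δ u) →
  ∃ λ E′ → E′ ⊆ᴬ arc D × IsFlow E′ σ (τ ⊕ δ w) ×
           (∀ a b → u ≢ a → u ≢ b → E′ a b ≡ E a b)
augment-step {E = E} {D = D} {u = u} {w = w} {σ = σ} {τ = τ} E⊆D uw flow with E w u in Ewu
... | true = E ∖ ⁅ w ⟶ u ⁆ , (λ a b e → E⊆D a b (proj₁ (∧-elim (E a b) e))) ,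
             shift (flow-∖ (⁅⁆-⊆ Ewu) flow (flow-⁅⁆ w u)) ,
             λ a b _ u≢b →
               trans (cong (λ z → E a b ∧ not z) (⁅⁆-target≢ {u = w} {a = a} (u≢b ∘ sym)))
                     (∧-identityʳ (E a b))
  where
  shift : IsFlow (E ∖ ⁅ w ⟶ u ⁆) (σ ⊕ δ u) ((τ ⊕ δ u) ⊕ δ w) →
          IsFlow (E ∖ ⁅ w ⟶ u ⁆) σ (τ ⊕ δ w)
  shift = flow-cancel (λ _ → refl) (λ a → xy∙z≈xz∙y (τ a) (δ u a) (δ w a))
... | false = E ∪ ⁅ u ⟶ w ⁆ , ⊆D ,
              shift (flow-∪ disjoint flow (flow-⁅⁆ u w)) ,
              λ a b u≢a _ →
                trans (cong (E a b ∨_) (⁅⁆-source≢ {w = w} {b = b} (u≢a ∘ sym)))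
                      (∨-identityʳ (E a b))
  where
  forward : arc D u w ∧ not (E u w) ≡ true
  forward with ∨-elim (arc D u w ∧ not (E u w)) uw
  ... | inj₁ fw = fw
  ... | inj₂ bw = ⊥-elim (false≢true (trans (sym (∧-zeroʳ (arc D w u))) bw))
  disjoint : Disjoint E ⁅ u ⟶ w ⁆
  disjoint a b e uw′ with ⁅⁆-true u w a b uw′
  ... | refl , refl = not-true (proj₂ (∧-elim (arc D u w) forward)) e
  ⊆D : (E ∪ ⁅ u ⟶ w ⁆) ⊆ᴬ arc D
  ⊆D a b e with ∨-elim (E a b) e
  ... | inj₁ e′  = E⊆D a b e′
  ... | inj₂ uw′ with ⁅⁆-true u w a b uw′
  ...   | refl , refl = proj₁ (∧-elim (arc D u w) forward)
  shift : IsFlow (E ∪ ⁅ u ⟶ w ⁆) (σ ⊕ δ u) ((τ ⊕ δ u) ⊕ δ w) →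
          IsFlow (E ∪ ⁅ u ⟶ w ⁆) σ (τ ⊕ δ w)
  shift = flow-cancel (λ _ → refl) (λ a → xy∙z≈xz∙y (τ a) (δ u a) (δ w a))

augment : E ⊆ᴬ arc D → IsPath (residual D E) x y vs → IsFlow E (σ ⊕ δ y) (τ ⊕ δ x) →
  ∃ λ E′ → E′ ⊆ᴬ arc D × IsFlow E′ σ τ
augment E⊆D (here , _) flow = _ , E⊆D , flow-cancel (λ _ → refl) (λ _ → refl) flow
augment {E = E} {D = D} {y = y} {vs = _ ∷ _} {σ = σ} {τ = τ} E⊆D
        (step {u = u} {w = w} uw W , u∉vs ∷ unique) flow
  with augment-step {E = E} {D = D} {u = u} {w = w} {σ = σ ⊕ δ y} {τ = τ} E⊆D uw flow
... | E′ , E′⊆D , flow′ , agree =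
  augment {D = D} {σ = σ} {τ = τ} E′⊆D
    (walk-transport (residual-agree {D = D} agree) u∉vs W , unique) flow′

cut+supply≤demand : E ⊆ᴬ arc D → IsFlow E σ τ → PredClosed (residual D E) Y →
  arcsBetween (arc D) (∁ Y) Y + sumOver Y σ ≤ sumOver Y τ
cut+supply≤demand {E = E} {D = D} {σ = σ} {τ = τ} {Y = Y} E⊆D flow closed = begin
  arcsBetween (arc D) (∁ Y) Y + sumOver Y σ  ≤⟨ +-monoˡ-≤ _ (arcsBetween-mono {S = ∁ Y} saturated) ⟩
  arcsBetween E (∁ Y) Y + sumOver Y σ        ≡⟨ flow-conservation flow Y ⟨
  arcsBetween E Y (∁ Y) + sumOver Y τ        ≡⟨ cong (_+ sumOver Y τ) noneLeaving ⟩
  sumOver Y τ                                ∎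
  where
  open ≤-Reasoning
  saturated : ∀ a b → ∁ Y a ≡ true → Y b ≡ true → arc D a b ≡ true → E a b ≡ true
  saturated a b ∁Ya Yb ab with E a b in Eab
  ... | true  = refl
  ... | false = ⊥-elim (not-true ∁Ya (closed a b (∨-introˡ _ (∧-intro ab (cong not Eab))) Yb))
  noneLeaving : arcsBetween E Y (∁ Y) ≡ 0
  noneLeaving = arcsBetween-none λ a b Ya ∁Yb Eab →
    not-true ∁Yb (closed b a (∨-introʳ _ (∧-intro (E⊆D a b Eab) Eab)) Ya)

arcDisjointPaths≤cut : ArcDisjointPaths D x y k → Y x ≡ false → Y y ≡ true →
  k ≤ arcsBetween (arc D) (∁ Y) Y
arcDisjointPaths≤cut {D = D} {x = x} {y = y} {k = k} {Y = Y} A Yx Yy = begin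
  k                                              ≡⟨ *-identityʳ k ⟨
  k * 1                                          ≡⟨ cong (λ p → k * 𝟙 p) Yy ⟨
  k * 𝟙 (Y y)                                    ≡⟨ sumOver-⊛δ Y k y ⟨
  sumOver Y (k ⊛ δ y)                            ≤⟨ m≤n+m _ (arcsBetween U Y (∁ Y)) ⟩
  arcsBetween U Y (∁ Y) + sumOver Y (k ⊛ δ y)    ≡⟨ flow-conservation (pathUnion-flow A) Y ⟩
  arcsBetween U (∁ Y) Y + sumOver Y (k ⊛ δ x)    ≡⟨ cong (arcsBetween U (∁ Y) Y +_) noSupply ⟩
  arcsBetween U (∁ Y) Y + 0                      ≡⟨ +-identityʳ _ ⟩
  arcsBetween U (∁ Y) Y                          ≤⟨ arcsBetween-mono {S = ∁ Y} (λ a b _ _ → U⊆D a b) ⟩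
  arcsBetween (arc D) (∁ Y) Y                    ∎
  where
  open ≤-Reasoning
  U : ArcSet _
  U = pathUnion A
  U⊆D : U ⊆ᴬ arc D
  U⊆D = pathUnion-⊆ A
  noSupply : sumOver Y (k ⊛ δ x) ≡ 0
  noSupply = trans (sumOver-⊛δ Y k x) (trans (cong (λ p → k * 𝟙 p) Yx) (*-zeroʳ k))

-- Deleting an arc

-- The hypothesis on E describes an s-t flow of value m with one unit diverted
-- to enter at y and leave at x.
reroute : E ⊆ᴬ arc D → IsFlow E ((m ⊛ δ s) ⊕ δ y) ((m ⊛ δ t) ⊕ δ x) →
  ArcDisjointPaths D x y k → m ≤ k → ArcDisjointPaths D s t m
reroute {E = E} {D = D} {m = m} {s = s} {y = y} {t = t} {x = x} {k = k} E⊆D flow Q m≤k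
  with reachOrSeparate (residual D E) x y
... | inj₁ (_ , W) with augment {σ = m ⊛ δ s} {τ = m ⊛ δ t} E⊆D (proj₂ (shortcut W)) flow
...   | E′ , E′⊆D , flow′ = flow⇒arcDisjointPaths m E′⊆D flow′
reroute {E = E} {D = D} {m = m} {s = s} {y = y} {t = t} {x = x} {k = k} E⊆D flow Q m≤k
  | inj₂ (Y , Yx , Yy , closed) = ⊥-elim (n≮n k (begin-strict
    k                                  ≤⟨ arcDisjointPaths≤cut Q Yx Yy ⟩
    cut                                <⟨ m<m+n cut supply≥1 ⟩
    cut + sumOver Y ((m ⊛ δ s) ⊕ δ y)  ≤⟨ cut+supply≤demand {E = E} {D = D} {τ = (m ⊛ δ t) ⊕ δ x}
                                                               E⊆D flow closed ⟩
    sumOver Y ((m ⊛ δ t) ⊕ δ x)        ≤⟨ demand≤m ⟩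
    m                                  ≤⟨ m≤k ⟩
    k                                  ∎))
  where
  open ≤-Reasoning
  cut : ℕ
  cut = arcsBetween (arc D) (∁ Y) Y
  supply≥1 : 0 < sumOver Y ((m ⊛ δ s) ⊕ δ y)
  supply≥1 = begin-strict
    0                                        <⟨ s≤s z≤n ⟩
    1                                        ≡⟨ cong 𝟙 Yy ⟨
    𝟙 (Y y)                                  ≡⟨ sumOver-δ Y y ⟨
    sumOver Y (δ y)                          ≤⟨ m≤n+m _ (sumOver Y (m ⊛ δ s)) ⟩
    sumOver Y (m ⊛ δ s) + sumOver Y (δ y)    ≡⟨ sumOver-⊕ Y (m ⊛ δ s) (δ y) ⟨
    sumOver Y ((m ⊛ δ s) ⊕ δ y)              ∎
  demand≤m : sumOver Y ((m ⊛ δ t) ⊕ δ x) ≤ m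
  demand≤m = begin
    sumOver Y ((m ⊛ δ t) ⊕ δ x)              ≡⟨ sumOver-⊕ Y (m ⊛ δ t) (δ x) ⟩
    sumOver Y (m ⊛ δ t) + sumOver Y (δ x)    ≡⟨ cong₂ _+_ (sumOver-⊛δ Y m t) (sumOver-δ Y x) ⟩
    m * 𝟙 (Y t) + 𝟙 (Y x)                    ≡⟨ cong (λ p → m * 𝟙 (Y t) + 𝟙 p) Yx ⟩
    m * 𝟙 (Y t) + 0                          ≡⟨ +-identityʳ _ ⟩
    m * 𝟙 (Y t)                              ≤⟨ *-monoʳ-≤ m (𝟙≤1 (Y t)) ⟩
    m * 1                                    ≡⟨ *-identityʳ m ⟩
    m                                        ∎

arcDisjointPaths-removeArc : ArcDisjointPaths (removeArc D x y) x y k → m ≤ k →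
  ArcDisjointPaths D s t m → ArcDisjointPaths (removeArc D x y) s t m
arcDisjointPaths-removeArc {D = D} {x = x} {y = y} {m = m} Q m≤k A with pathUnion A x y in Uxy
... | false = flow⇒arcDisjointPaths m (⊆-removeArc {D = D} (pathUnion-⊆ A) Uxy) (pathUnion-flow A)
... | true  = reroute {E = U ∖ ⁅ x ⟶ y ⁆} U′⊆D′
                (flow-∖ (⁅⁆-⊆ Uxy) (pathUnion-flow A) (flow-⁅⁆ x y)) Q m≤k
  where
  U : ArcSet _
  U = pathUnion A
  U′⊆D′ : (U ∖ ⁅ x ⟶ y ⁆) ⊆ᴬ arc (removeArc D x y)
  U′⊆D′ a b e = let (Uab , ab≢xy) = ∧-elim (U a b) e in ∧-intro (pathUnion-⊆ A a b Uab) ab≢xy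

-- Certificates

addDirectPath : H ⊆ᴳ G → arc G x y ≡ true → arc H x y ≡ false → x ≢ y →
  NodeDisjointPaths H x y m → NodeDisjointPaths G x y (suc m)
addDirectPath {H = H} {G = G} {x = x} {y = y} {m = m} H⊆G Gxy Hxy x≢y (Ps , paths , disjoint) =
  Ps′ , paths′ , disjoint′
  where
  Ps′ : Fin (suc m) → List (Fin _)
  Ps′ zero    = x ∷ y ∷ []
  Ps′ (suc i) = Ps i
  paths′ : ∀ i → IsPath G x y (Ps′ i)
  paths′ zero    = step Gxy here , (x≢y ∷ []) ∷ [] ∷ []
  paths′ (suc i) = walk-⊆ H⊆G (proj₁ (paths i)) , proj₂ (paths i)
  indirect : ∀ i → Ps i ≢ x ∷ y ∷ []
  indirect i Psi≡xy = false≢true (trans (sym Hxy) (arcSet-walk (proj₁ (paths i)) x y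
    (subst (λ vs → arcSet vs x y ≡ true) (sym Psi≡xy) (∨-introˡ false (⁅⁆-self x y)))))
  disjoint′ : ∀ i j → i ≢ j →
    (Ps′ i ≢ Ps′ j) × (∀ v → v ∈ internal (Ps′ i) → v ∈ internal (Ps′ j) → ⊥)
  disjoint′ zero    zero    i≢j = ⊥-elim (i≢j refl)
  disjoint′ zero    (suc j) _   = indirect j ∘ sym , λ _ ()
  disjoint′ (suc i) zero    _   = indirect i , λ _ _ ()
  disjoint′ (suc i) (suc j) i≢j = disjoint i j (i≢j ∘ cong suc)

missingArc⇒nodeDisjointPaths : NodeCertificate k G H → arc G x y ≡ true → arc H x y ≡ false →
  ∀ j → j ≤ k → NodeDisjointPaths H x y j
missingArc⇒nodeDisjointPaths _ _ _ zero _ = (λ ()) , (λ ()) , (λ ())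
missingArc⇒nodeDisjointPaths {G = G} {x = x} {y = y} cert Gxy Hxy (suc j) j<k =
  proj₂ cert x y x≢y (suc j) j<k
    (addDirectPath (proj₁ cert) Gxy Hxy x≢y (missingArc⇒nodeDisjointPaths cert Gxy Hxy j (<⇒≤ j<k)))
  where
  x≢y : x ≢ y
  x≢y refl = false≢true (trans (sym (loopless G x)) Gxy)

nodeCertificate-⊆ : H ⊆ᴳ G → G ⊆ᴳ D → NodeCertificate k D H → NodeCertificate k G H
nodeCertificate-⊆ H⊆G G⊆D (_ , cert) =
  H⊆G , λ s t s≢t m m≤k Ps → cert s t s≢t m m≤k (nodeDisjointPaths-mono G⊆D Ps)

arcDisjointPaths-prune : ∀ L → NodeCertificate k G H →
  (∀ a b → arc G a b ≡ true → arc H a b ≡ false → (a , b) ∈ L) →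
  m ≤ k → ArcDisjointPaths G s t m → ArcDisjointPaths H s t m
arcDisjointPaths-prune {G = G} {H = H} [] _ listed _ = arcDisjointPaths-mono G⊆H
  where
  G⊆H : G ⊆ᴳ H
  G⊆H a b Gab with arc H a b in Hab
  ... | true  = refl
  ... | false with listed a b Gab Hab
  ...   | ()
arcDisjointPaths-prune {k = k} {G = G} {H = H} ((x , y) ∷ L) cert listed m≤k A
  with arc G x y ∧ not (arc H x y) in removable
... | false = arcDisjointPaths-prune L cert listed′ m≤k A
  where
  listed′ : ∀ a b → arc G a b ≡ true → arc H a b ≡ false → (a , b) ∈ L
  listed′ a b Gab Hab with listed a b Gab Hab
  ... | there ab∈L = ab∈L
  ... | here refl  = ⊥-elim (false≢true (trans (sym removable) (∧-intro Gab (cong not Hab))))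
... | true = arcDisjointPaths-prune L (nodeCertificate-⊆ H⊆G′ (removeArc-⊆ {D = G}) cert) listed′ m≤k
               (arcDisjointPaths-removeArc Q m≤k A)
  where
  G′ : Digraph _
  G′ = removeArc G x y
  Gxy : arc G x y ≡ true
  Gxy = proj₁ (∧-elim (arc G x y) removable)
  Hxy : arc H x y ≡ false
  Hxy = not-injective {x = arc H x y} {y = false} (proj₂ (∧-elim (arc G x y) removable))
  H⊆G′ : H ⊆ᴳ G′
  H⊆G′ = ⊆-removeArc {D = G} (proj₁ cert) Hxy
  Q : ArcDisjointPaths G′ x y k
  Q = arcDisjointPaths-mono H⊆G′
        (nodeDisjoint⇒arcDisjoint (missingArc⇒nodeDisjointPaths cert Gxy Hxy k ≤-refl))
  listed′ : ∀ a b → arc G′ a b ≡ true → arc H a b ≡ false → (a , b) ∈ L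
  listed′ a b G′ab Hab with listed a b (removeArc-⊆ {D = G} a b G′ab) Hab
  ... | there ab∈L = ab∈L
  ... | here refl  = ⊥-elim (removeArc-removes {D = G} G′ab)

lemma1p1 : ∀ {n : ℕ} (k : ℕ) (G H : Digraph n) →
    NodeCertificate k G H → ArcCertificate k G H
lemma1p1 {n} k G H cert =
  proj₁ cert , λ s t _ m m≤k → arcDisjointPaths-prune allPairs cert listed m≤k
  where
  allPairs : List (Fin n × Fin n)
  allPairs = cartesianProduct (allFin n) (allFin n)
  listed : ∀ a b → arc G a b ≡ true → arc H a b ≡ false → (a , b) ∈ allPairs
  listed a b _ _ = ∈-cartesianProduct⁺ (∈-allFin a) (∈-allFin b)
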